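{- Let $M=(W,\{\sim_x\}_{x\in V},\{\mathcal{T}_w\}_{w\in W},\pi)$ be any trustworthiness model, $w\in W$ any world, $U\subseteq V$ any dataset, $F\subseteq\Phi$ any set of formulae and $\phi\in\Phi$ any formula. If $w,U\Vdash f$ for each formula $f\in F$ and $F\vdash\phi$, then $w,U\Vdash\phi$.
   Context: Fix a set $V$ of data variables and a set of atomic propositions. A dataset is a subset of $V$. The language $\Phi$ is generated by $\phi::=p\mid\neg\phi\mid\phi\to\phi\mid{\sf B}^T_X\phi\mid[X]\phi$, where $p$ is an atomic proposition and $X,T\subseteq V$; $\leftrightarrow$ and $\bot$ are defined as usual. A trustworthiness model is a tuple $(W,\{\sim_x\}_{x\in V},\{\mathcal{T}_w\}_{w\in W},\pi)$ where $W$ is a (possibly empty) set of worlds, each $\sim_x$ is an equivalence relation on $W$, $\mathcal{T}_w\subseteq V$ for each $w\in W$, and $\pi(p)\subseteq W\times\mathcal{P}(V)$ for each atomic proposition $p$. Write $w\sim_X u$ if $w\sim_x u$ for every $x\in X$. Satisfaction $w,U\Vdash\phi$ (for $w\in W$, $U\subseteq V$) is defined by: $w,U\Vdash p$ iff $(w,U)\in\pi(p)$; $w,U\Vdash\neg\phi$ iff $w,U\nVdash\phi$; $w,U\Vdash\phi\to\psi$ iff $w,U\nVdash\phi$ or $w,U\Vdash\psi$; $w,U\Vdash{\sf B}^T_X\phi$ iff $w',U\Vdash\phi$ for every $w'\in W$ with $w\sim_{X\cup U}w'$ and $T\subseteq\mathcal{T}_{w'}$; $w,U\Vdash[X]\phi$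 iff $w,U\cup X\Vdash\phi$. The axioms are all propositional tautologies in $\Phi$ and all instances (for arbitrary datasets $X,Y,T,T'\!,X'$ and formulae $\phi,\psi$) of: Truth ${\sf B}^\varnothing_X\phi\to\phi$; Distributivity ${\sf B}^T_X(\phi\to\psi)\to({\sf B}^T_X\phi\to{\sf B}^T_X\psi)$ and $[X](\phi\to\psi)\to([X]\phi\to[X]\psi)$; Negative Introspection $\neg{\sf B}^T_X\phi\to{\sf B}^\varnothing_X\neg{\sf B}^T_X\phi$; Monotonicity ${\sf B}^T_X\phi\to{\sf B}^{T'}_{X'}\phi$ for $T\subseteq T'$, $X\subseteq X'$; Trust ${\sf B}^T_X({\sf B}^T_Y\phi\to\phi)$; Combination $[X][Y]\phi\leftrightarrow[X\cup Y]\phi$; Commutativity $[Y]{\sf B}^T_X\phi\leftrightarrow{\sf B}^T_{Y\cup X}[Y]\phi$; Duality $\neg[X]\phi\leftrightarrow[X]\neg\phi$; Empty Announcement $[\varnothing]\phi\leftrightarrow\phi$. The inference rules are Modus Ponens, and Necessitation: from $\phi$ infer ${\sf B}^T_X\phi$, and from $\phi$ infer $[X]\phi$. $\vdash\phi$ means $\phi$ is derivable from the axioms by these rules (a theorem). $F\vdash\phi$ means $\phi$ is derivable from the theorems together with the formulae in $F$ using Modus Ponens only. -}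

module Defs where

open import Level using (0ℓ)
open import Data.Bool using (Bool; true; false; not; _∨_)
open import Data.Product using (_×_; _,_)
open import Data.Sum using (_⊎_)
open import Relation.Nullary using (¬_)
open import Relation.Unary using (Pred; _⊆_; _∪_; ∅; _≐_)
open import Relation.Binary using (Rel; IsEquivalence)
open import Relation.Binary.PropositionalEquality using (_≡_)

Dataset : Set → Set₁
Dataset V = Pred V 0ℓ

module _ {V : Set} {Atom : Set} where

  data Form : Set₁ where
    atom : Atom → Form
    ¬'_  : Form → Form
    _⇒_  : Form → Form → Form
    B    : (T X : Dataset V) → Form → Form
    [_]_ : Dataset V → Form → Form

  infixr 5 _⇒_
  infix 4 _⇔_
  infix 7 ¬'_
  infixr 7 [_]_

  -- φ ↔ ψ defined as usual: (φ → ψ) ∧ (ψ → φ), with a ∧ b = ¬(a → ¬ b).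
  _⇔_ : Form → Form → Form
  φ ⇔ ψ = ¬' ((φ ⇒ ψ) ⇒ ¬' (ψ ⇒ φ))

  -- Propositional evaluation: formulas not of the form ¬φ or φ→ψ are
  -- treated as propositional atoms, valued by v.
  evalB : (Form → Bool) → Form → Bool
  evalB v (atom p)    = v (atom p)
  evalB v (¬' φ)      = not (evalB v φ)
  evalB v (φ ⇒ ψ)     = not (evalB v φ) ∨ evalB v ψ
  evalB v (B T X φ)   = v (B T X φ)
  evalB v ([ X ] φ)   = v ([ X ] φ)

  Tautology : Form → Set₁
  Tautology φ = ∀ (v : Form → Bool) → evalB v φ ≡ true

  data Thm : Form → Set₁ where
    taut     : ∀ {φ} → Tautology φ → Thm φ
    truth    : ∀ {X φ} → Thm (B ∅ X φ ⇒ φ)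
    distB    : ∀ {T X φ ψ} → Thm (B T X (φ ⇒ ψ) ⇒ (B T X φ ⇒ B T X ψ))
    distA    : ∀ {X φ ψ} → Thm ([ X ] (φ ⇒ ψ) ⇒ ([ X ] φ ⇒ [ X ] ψ))
    negIntro : ∀ {T X φ} → Thm (¬' (B T X φ) ⇒ B ∅ X (¬' (B T X φ)))
    mono     : ∀ {T T' X X' φ} → T ⊆ T' → X ⊆ X' → Thm (B T X φ ⇒ B T' X' φ)
    trust    : ∀ {T X Y φ} → Thm (B T X (B T Y φ ⇒ φ))
    comb     : ∀ {X Y φ} → Thm ([ X ] ([ Y ] φ) ⇔ [ X ∪ Y ] φ)
    commut   : ∀ {T X Y φ} → Thm ([ Y ] (B T X φ) ⇔ B T (Y ∪ X) ([ Y ] φ))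
    duality  : ∀ {X φ} → Thm (¬' ([ X ] φ) ⇔ [ X ] (¬' φ))
    emptyAnn : ∀ {φ} → Thm ([ ∅ ] φ ⇔ φ)
    mp       : ∀ {φ ψ} → Thm (φ ⇒ ψ) → Thm φ → Thm ψ
    necB     : ∀ {T X φ} → Thm φ → Thm (B T X φ)
    necA     : ∀ {X φ} → Thm φ → Thm ([ X ] φ)

  data _⊢_ (F : Form → Set) : Form → Set₁ where
    fromThm : ∀ {φ} → Thm φ → F ⊢ φ
    fromHyp : ∀ {φ} → F φ → F ⊢ φ
    mpF     : ∀ {φ ψ} → F ⊢ (φ ⇒ ψ) → F ⊢ φ → F ⊢ ψ

  infix 3 _⊢_

  record Model : Set₁ where
    field
      W       : Set
      sim     : V → Rel W 0ℓ
      simEquiv : ∀ x → IsEquivalence (sim x)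
      𝒯       : W → Dataset V
      π       : Atom → W → Dataset V → Set
      -- datasets are sets: π(p) does not distinguish extensionally equal datasets
      πExt    : ∀ p w {U U'} → U ≐ U' → π p w U → π p w U'

  module _ (M : Model) where
    open Model M

    simSet : Dataset V → W → W → Set
    simSet X w u = ∀ {x} → X x → sim x w u

    Sat : W → Dataset V → Form → Set
    Sat w U (atom p)  = π p w U
    Sat w U (¬' φ)    = ¬ Sat w U φ
    Sat w U (φ ⇒ ψ)   = (¬ Sat w U φ) ⊎ Sat w U ψ
    Sat w U (B T X φ) = ∀ (w' : W) → simSet (X ∪ U) w w' → T ⊆ 𝒯 w' → Sat w' U φ
    Sat w U ([ X ] φ) = Sat w (U ∪ X) φ

{-# OPTIONS --safe #-}
module Submission where

open import Defs
open import Level using (0ℓ)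
open import Axiom.ExcludedMiddle using (ExcludedMiddle)
open import Data.Bool using (Bool)
open import Data.Empty using (⊥-elim)
open import Data.Product using (_,_; proj₁; proj₂)
open import Data.Sum using (_⊎_; inj₁; inj₂; [_,_]; map₁; map₂; assocʳ; assocˡ; fromInj₁)
open import Function using (id)
open import Relation.Nullary using (¬_; yes; no)
open import Relation.Nullary.Decidable using (does; proof)
open import Relation.Nullary.Reflects using (Reflects; invert; ¬-reflects; _⊎-reflects_)
open import Relation.Unary using (_⊆_; _∪_; ∅; _≐_)
open import Relation.Unary.Properties using (≐-sym)
open import Relation.Binary using (IsEquivalence)
open import Relation.Binary.PropositionalEquality using (subst)

-- Every theorem holds at every pair (w , U): each axiom is checked directly,
-- and the necessitation rules preserve this universal validity (for B by
-- moving to other worlds, for [X] by moving to the dataset U ∪ X).  The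
-- hypotheses in F hold only at the given pair, which suffices because F ⊢ φ
-- uses Modus Ponens alone.  Excluded middle is needed because an implication
-- is interpreted as ¬ A ⊎ B, and because tautologies are evaluated under the
-- Boolean valuation ψ ↦ (w , U ⊩ ψ).

¬⊎⇒→ : {A B : Set} → ¬ A ⊎ B → A → B
¬⊎⇒→ (inj₁ ¬a) a = ⊥-elim (¬a a)
¬⊎⇒→ (inj₂ b) _ = b

module ModelProperties {V Atom : Set} (M : Model {V} {Atom}) where
  open Model M

  simSet-refl : ∀ {X w} → simSet M X w w
  simSet-refl {x = x} _ = IsEquivalence.refl (simEquiv x)

  simSet-sym : ∀ {X w u} → simSet M X w u → simSet M X u w
  simSet-sym w∼u {x} x∈X = IsEquivalence.sym (simEquiv x) (w∼u x∈X)

  simSet-trans : ∀ {X w u z} → simSet M X w u → simSet M X u z → simSet M X w z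
  simSet-trans w∼u u∼z {x} x∈X = IsEquivalence.trans (simEquiv x) (w∼u x∈X) (u∼z x∈X)

  simSet-antimono : ∀ {X Y w u} → X ⊆ Y → simSet M Y w u → simSet M X w u
  simSet-antimono X⊆Y w∼u x∈X = w∼u (X⊆Y x∈X)

  -- Needed because Combination and Empty Announcement identify datasets
  -- (U ∪ X) ∪ Y with U ∪ (X ∪ Y) and U ∪ ∅ with U, which are only ≐, not ≡.
  Sat-resp-≐ : ∀ φ {w} {U U' : Dataset V} → U ≐ U' → Sat M w U φ → Sat M w U' φ
  Sat-resp-≐ (atom p)  U≐U' = πExt p _ U≐U'
  Sat-resp-≐ (¬' φ)    U≐U' ¬sat sat = ¬sat (Sat-resp-≐ φ (≐-sym U≐U') sat)
  Sat-resp-≐ (φ ⇒ ψ)   U≐U' =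
    Data.Sum.map (λ ¬sat sat → ¬sat (Sat-resp-≐ φ (≐-sym U≐U') sat)) (Sat-resp-≐ ψ U≐U')
  Sat-resp-≐ (B T X φ) U≐U' sat w' w∼w' T⊆𝒯 =
    Sat-resp-≐ φ U≐U' (sat w' (simSet-antimono (map₂ (proj₁ U≐U')) w∼w') T⊆𝒯)
  Sat-resp-≐ ([ X ] φ) (U⊆U' , U'⊆U) = Sat-resp-≐ φ (map₁ U⊆U' , map₁ U'⊆U)

module Classical (em : ExcludedMiddle 0ℓ) where

  →⇒¬⊎ : {A B : Set} → (A → B) → ¬ A ⊎ B
  →⇒¬⊎ {A} f with em {A}
  ... | yes a = inj₂ (f a)
  ... | no ¬a = inj₁ ¬a

  -- The shape of Sat M w U (φ ⇔ ψ), with φ ⇔ ψ = ¬ ((φ ⇒ ψ) ⇒ ¬ (ψ ⇒ φ)).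
  ↔⇒¬¬⊎¬ : {A B : Set} → (A → B) → (B → A) → ¬ (¬ (¬ A ⊎ B) ⊎ ¬ (¬ B ⊎ A))
  ↔⇒¬¬⊎¬ f g = [ (λ ¬f → ¬f (→⇒¬⊎ f)) , (λ ¬g → ¬g (→⇒¬⊎ g)) ]

  module _ {V Atom : Set} (M : Model {V} {Atom}) where
    open Model M
    open ModelProperties M

    satisfactionValuation : W → Dataset V → Form {V} {Atom} → Bool
    satisfactionValuation w U ψ = does (em {Sat M w U ψ})

    evalB-reflects-Sat : ∀ {w U} φ → Reflects (Sat M w U φ) (evalB (satisfactionValuation w U) φ)
    evalB-reflects-Sat {w} {U} (atom p)  = proof (em {Sat M w U (atom p)})
    evalB-reflects-Sat         (¬' φ)    = ¬-reflects (evalB-reflects-Sat φ)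
    evalB-reflects-Sat         (φ ⇒ ψ)   = ¬-reflects (evalB-reflects-Sat φ) ⊎-reflects evalB-reflects-Sat ψ
    evalB-reflects-Sat {w} {U} (B T X φ) = proof (em {Sat M w U (B T X φ)})
    evalB-reflects-Sat {w} {U} ([ X ] φ) = proof (em {Sat M w U ([ X ] φ)})

    Tautology-sound : ∀ {φ} → Tautology φ → ∀ w U → Sat M w U φ
    Tautology-sound {φ} tautological w U =
      invert (subst (Reflects _) (tautological (satisfactionValuation w U)) (evalB-reflects-Sat φ))

    Thm-sound : ∀ {φ} → Thm φ → ∀ w U → Sat M w U φ
    Thm-sound (taut {φ} t) = Tautology-sound {φ} t
    Thm-sound (truth {X}) w U = →⇒¬⊎ λ B∅φ → B∅φ w (simSet-refl {X ∪ U}) (λ ())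
    Thm-sound distB w U = →⇒¬⊎ λ Bφ⇒ψ → →⇒¬⊎ λ Bφ w' w∼w' T⊆𝒯 →
      ¬⊎⇒→ (Bφ⇒ψ w' w∼w' T⊆𝒯) (Bφ w' w∼w' T⊆𝒯)
    Thm-sound distA w U = →⇒¬⊎ λ [X]φ⇒ψ → →⇒¬⊎ (¬⊎⇒→ [X]φ⇒ψ)
    Thm-sound (negIntro {X = X}) w U = →⇒¬⊎ λ ¬Bφ w' w∼w' _ Bφ →
      ¬Bφ (λ w'' w∼w'' → Bφ w'' (simSet-trans {X ∪ U} (simSet-sym w∼w') w∼w''))
    Thm-sound (mono {X' = X'} T⊆T' X⊆X') w U = →⇒¬⊎ λ Bφ w' w∼w' T'⊆𝒯 →
      Bφ w' (simSet-antimono {Y = X' ∪ U} (map₁ X⊆X') w∼w') (λ x∈T → T'⊆𝒯 (T⊆T' x∈T))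
    Thm-sound (trust {Y = Y}) w U w' _ T⊆𝒯 = →⇒¬⊎ λ Bφ → Bφ w' (simSet-refl {Y ∪ U}) T⊆𝒯
    Thm-sound (comb {φ = φ}) w U =
      ↔⇒¬¬⊎¬ (Sat-resp-≐ φ (assocʳ , assocˡ)) (Sat-resp-≐ φ (assocˡ , assocʳ))
    Thm-sound (commut {T} {X} {Y} {φ}) w U = ↔⇒¬¬⊎¬ forth back
      where
      reindex : X ∪ (U ∪ Y) ≐ (Y ∪ X) ∪ U
      reindex = (λ { (inj₁ x)        → inj₁ (inj₂ x)
                   ; (inj₂ (inj₁ u)) → inj₂ u
                   ; (inj₂ (inj₂ y)) → inj₁ (inj₁ y) })
              , (λ { (inj₁ (inj₁ y)) → inj₂ (inj₂ y)
                   ; (inj₁ (inj₂ x)) → inj₁ x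
                   ; (inj₂ u)        → inj₂ (inj₁ u) })

      forth : Sat M w U ([ Y ] B T X φ) → Sat M w U (B T (Y ∪ X) ([ Y ] φ))
      forth sat w' w∼w' = sat w' (simSet-antimono (proj₁ reindex) w∼w')

      back : Sat M w U (B T (Y ∪ X) ([ Y ] φ)) → Sat M w U ([ Y ] B T X φ)
      back sat w' w∼w' = sat w' (simSet-antimono (proj₂ reindex) w∼w')
    Thm-sound duality w U = ↔⇒¬¬⊎¬ id id
    Thm-sound (emptyAnn {φ}) w U =
      ↔⇒¬¬⊎¬ (Sat-resp-≐ φ U∪∅≐U) (Sat-resp-≐ φ (≐-sym U∪∅≐U))
      where
      U∪∅≐U : U ∪ ∅ ≐ U
      U∪∅≐U = fromInj₁ (λ ()) , inj₁
    Thm-sound (mp ⊢φ⇒ψ ⊢φ) w U = ¬⊎⇒→ (Thm-sound ⊢φ⇒ψ w U) (Thm-sound ⊢φ w U)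
    Thm-sound (necB ⊢φ) w U w' _ _ = Thm-sound ⊢φ w' U
    Thm-sound (necA {X} ⊢φ) w U = Thm-sound ⊢φ w (U ∪ X)

theorem1 : ExcludedMiddle 0ℓ →
    {V Atom : Set} (M : Model {V} {Atom}) (w : Model.W M) (U : Dataset V)
    (F : Form {V} {Atom} → Set) (φ : Form {V} {Atom}) →
    (∀ f → F f → Sat M w U f) → F ⊢ φ → Sat M w U φ
theorem1 em M w U F φ F-holds (fromThm ⊢φ) = Classical.Thm-sound em M ⊢φ w U
theorem1 em M w U F φ F-holds (fromHyp φ∈F) = F-holds φ φ∈F
theorem1 em M w U F φ F-holds (mpF {ψ} F⊢ψ⇒φ F⊢ψ) =
  ¬⊎⇒→ (theorem1 em M w U F (ψ ⇒ φ) F-holds F⊢ψ⇒φ) (theorem1 em M w U F ψ F-holds F⊢ψ)
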